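{- Let $(\mathcal{N},M,M')$ be a Petri net system with $\mathcal{N}=(P,T,\mathrm{Pre},\mathrm{Post})$ acyclic and incidence matrix $\mathcal{A}$. Then $(\mathcal{N},M,M')$ admits a cut-off if and only if the marking equation $M'=M+\mathcal{A}\mathbf{v}$ has a solution $\mathbf{x}\in\mathbb{Q}_{\ge 0}^T$ and a solution $\mathbf{y}\in\mathbb{Z}^T$ such that $\mathrm{supp}(\mathbf{y})\subseteq\mathrm{supp}(\mathbf{x})$.
   Context: A Petri net is $\mathcal{N}=(P,T,\mathrm{Pre},\mathrm{Post})$ with finite sets $P$ (places), $T$ (transitions) and matrices $\mathrm{Pre},\mathrm{Post}\in\mathbb{N}^{P\times T}$; its incidence matrix is $\mathcal{A}=\mathrm{Post}-\mathrm{Pre}$. A marking is $M\in\mathbb{N}^P$; $t$ is enabled at $M$ if $M(p)\ge\mathrm{Pre}[p,t]$ for all $p$, and firing yields $M'=M+\mathcal{A}[\cdot,t]$. $M\xrightarrow{*}M'$ means reachability by a finite sequence of firings. A Petri net system is $(\mathcal{N},M,M')$ with markings $M\neq M'$; it admits a cut-off if there is $B\in\mathbb{N}$ with $n\cdot M\xrightarrow{*}n\cdot M'$ for all $n\ge B$. $\mathcal{N}$ is acyclic if the directed graph with vertex set $P\cup T$ and edges $(p,t)$ whenever $\mathrm{Pre}[p,t]>0$ and $(t,p)$ whenever $\mathrm{Post}[p,t]>0$ has no cycle. The support of a vector $\mathbf{v}$ is $\mathrm{supp}(\mathbf{v})=\{t:\mathbf{v}(t)\neq 0\}$. -}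

module Defs where

open import Data.Nat as ℕ using (ℕ; zero; suc)
open import Data.Fin using (Fin; zero; suc)
open import Data.Integer as ℤ using (ℤ)
open import Data.Rational as ℚ using (ℚ)
open import Data.Sum using (_⊎_; inj₁; inj₂)
open import Data.Product using (_×_; Σ)
open import Data.Empty using (⊥)
open import Relation.Nullary using (¬_)
open import Relation.Binary.PropositionalEquality using (_≡_)

record PetriNet (np nt : ℕ) : Set where
  field
    Pre  : Fin np → Fin nt → ℕ
    Post : Fin np → Fin nt → ℕ
open PetriNet public

Marking : ℕ → Set
Marking np = Fin np → ℕ

incidence : ∀ {np nt} → PetriNet np nt → Fin np → Fin nt → ℤ
incidence N p t = ℤ.+ (Post N p t) ℤ.- ℤ.+ (Pre N p t)

Enabled : ∀ {np nt} → PetriNet np nt → Marking np → Fin nt → Set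
Enabled N M t = ∀ p → Pre N p t ℕ.≤ M p

-- firing t at M yields M' (M' = M + A[.,t], i.e. M' + Pre = M + Post)
Fires : ∀ {np nt} → PetriNet np nt → Marking np → Fin nt → Marking np → Set
Fires N M t M' = Enabled N M t × (∀ p → M' p ℕ.+ Pre N p t ≡ M p ℕ.+ Post N p t)

data Reach {np nt} (N : PetriNet np nt) : Marking np → Marking np → Set where
  done : ∀ {M M'} → (∀ p → M p ≡ M' p) → Reach N M M'
  step : ∀ {M M₁ M'} (t : Fin nt) → Fires N M t M₁ → Reach N M₁ M' → Reach N M M'

_·_ : ∀ {np} → ℕ → Marking np → Marking np
(n · M) p = n ℕ.* M p

AdmitsCutoff : ∀ {np nt} → PetriNet np nt → Marking np → Marking np → Set
AdmitsCutoff N M M' = Σ ℕ λ B → ∀ n → B ℕ.≤ n → Reach N (n · M) (n · M')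

Edge : ∀ {np nt} → PetriNet np nt → Fin np ⊎ Fin nt → Fin np ⊎ Fin nt → Set
Edge N (inj₁ p) (inj₁ q) = ⊥
Edge N (inj₁ p) (inj₂ t) = 0 ℕ.< Pre N p t
Edge N (inj₂ t) (inj₁ p) = 0 ℕ.< Post N p t
Edge N (inj₂ t) (inj₂ u) = ⊥

data Path {np nt} (N : PetriNet np nt) : Fin np ⊎ Fin nt → Fin np ⊎ Fin nt → Set where
  edge : ∀ {u v} → Edge N u v → Path N u v
  cons : ∀ {u v w} → Edge N u v → Path N v w → Path N u w

Acyclic : ∀ {np nt} → PetriNet np nt → Set
Acyclic N = ∀ v → ¬ Path N v v

sumℚ : ∀ {n} → (Fin n → ℚ) → ℚ
sumℚ {zero} f = ℚ.0ℚ
sumℚ {suc n} f = f zero ℚ.+ sumℚ (λ i → f (suc i))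

sumℤ : ∀ {n} → (Fin n → ℤ) → ℤ
sumℤ {zero} f = ℤ.0ℤ
sumℤ {suc n} f = f zero ℤ.+ sumℤ (λ i → f (suc i))

MarkingEqℚ : ∀ {np nt} → PetriNet np nt → Marking np → Marking np → (Fin nt → ℚ) → Set
MarkingEqℚ N M M' v = ∀ p →
  (ℤ.+ (M' p) ℚ./ 1) ≡ (ℤ.+ (M p) ℚ./ 1) ℚ.+ sumℚ (λ t → (incidence N p t ℚ./ 1) ℚ.* v t)

MarkingEqℤ : ∀ {np nt} → PetriNet np nt → Marking np → Marking np → (Fin nt → ℤ) → Set
MarkingEqℤ N M M' v = ∀ p →
  ℤ.+ (M' p) ≡ ℤ.+ (M p) ℤ.+ sumℤ (λ t → incidence N p t ℤ.* v t)

SuppSubset : ∀ {nt} → (Fin nt → ℤ) → (Fin nt → ℚ) → Set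
SuppSubset y x = ∀ t → ¬ (y t ≡ ℤ.0ℤ) → ¬ (x t ≡ ℚ.0ℚ)

-- Call z ∈ ℕ^T a solution for (M, M') if M' = M + A z. In an acyclic net every solution is
-- realised by a run: "u feeds t" (some place is an output of u and an input of t) is well
-- founded, so supp z contains a transition t fed by no transition of supp z. No transition
-- counted by z refills the input places of t, so t is enabled at M, and firing it leaves the
-- solution z − e_t. Hence n·M →* n·M' iff (n·M, n·M') has a solution in ℕ^T.
-- For a cut-off B, the Parikh vectors v₁, v₀ of runs for B + 1 and B give the integer solution
-- y = v₁ − v₀ and the rational solution x = (v₁ + v₀)/(2B + 1), with supp y ⊆ supp x.
-- Conversely, clearing the denominators of x gives a ∈ ℕ^T with supp a = supp x solving
-- (D·M, D·M'); for n = qD + r the vector q a + r y solves (n·M, n·M') and is nonnegative for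
-- large n, because supp y ⊆ supp a.

module Submission where

open import Defs
open import Data.Nat using (ℕ)
open import Data.Fin using (Fin)
open import Data.Integer using (ℤ)
open import Data.Rational using (ℚ; 0ℚ; _≤_)
open import Data.Product using (_×_; Σ)
open import Relation.Nullary using (¬_)
open import Relation.Binary.PropositionalEquality using (_≡_)
open import Function.Bundles using (_⇔_)

open import Level using (0ℓ)
open import Data.Nat as ℕ using (zero; suc; z≤n)
import Data.Nat.Properties as ℕP
open import Data.Nat.DivMod using (_/_; _%_; m≡m%n+[m/n]*n; m%n<n; m*n/n≡m; /-monoˡ-≤)
open import Data.Fin using (zero; suc)
open import Data.Fin.Properties using (any?)
open import Data.Fin.Induction using (spo-wellFounded)
open import Data.Integer as ℤ using (+_; -[1+_])
import Data.Integer.Properties as ℤP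
open import Data.Integer.Tactic.RingSolver using (solve-∀)
open import Data.Rational as ℚ using (mkℚ; ↥_; ↧_; ↧ₙ_)
import Data.Rational.Properties as ℚP
open import Data.Rational.Unnormalised as ℚᵘ using (mkℚᵘ; *≡*)
import Data.Rational.Unnormalised.Properties as ℚᵘP
open import Data.Product using (_,_; ∃)
open import Data.Sum using (inj₁; inj₂)
open import Function.Base using (_∘_; case_of_)
open import Function.Bundles using (mk⇔; Equivalence)
open import Algebra.Bundles using (CommutativeRing; CommutativeMonoid; AbelianGroup)
import Algebra.Properties.CommutativeSemigroup as CommutativeSemigroupProperties
import Algebra.Properties.Group as GroupProperties
import Algebra.Properties.Semiring.Sum as SemiringSum
open import Induction.WellFounded using (WellFounded; Acc; acc)
open import Relation.Nullary using (yes; no; contradiction)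
open import Relation.Nullary.Decidable using (_×-dec_)
open import Relation.Unary as U using (Pred)
open import Relation.Binary using (Rel; Decidable)
open import Relation.Binary.Construct.Closure.Transitive using (TransClosure; [_]; _∷_; _++_; wellFounded⁻)
open import Relation.Binary.PropositionalEquality
  using (_≢_; refl; sym; trans; cong; cong₂; subst; isEquivalence; resp₂; module ≡-Reasoning)

module ℕΣ = SemiringSum ℕP.+-*-semiring
module ℤΣ = SemiringSum ℤP.+-*-semiring
module ℚΣ = SemiringSum (CommutativeRing.semiring ℚP.+-*-commutativeRing)
module ℕ+ = CommutativeSemigroupProperties ℕP.+-commutativeSemigroup
module ℤ* = CommutativeSemigroupProperties ℤP.*-commutativeSemigroup
module ℚ* = CommutativeSemigroupProperties (CommutativeMonoid.commutativeSemigroup ℚP.*-1-commutativeMonoid)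
module ℤ+ = GroupProperties (AbelianGroup.group ℤP.+-0-abelianGroup)
module ℚ+ = GroupProperties ℚP.+-0-group

private
  variable
    np nt : ℕ

sumℤ≡sum : ∀ {n} (f : Fin n → ℤ) → sumℤ f ≡ ℤΣ.sum f
sumℤ≡sum {zero}  f = refl
sumℤ≡sum {suc n} f = cong (ℤ._+_ (f zero)) (sumℤ≡sum (f ∘ suc))

sumℚ≡sum : ∀ {n} (f : Fin n → ℚ) → sumℚ f ≡ ℚΣ.sum f
sumℚ≡sum {zero}  f = refl
sumℚ≡sum {suc n} f = cong (ℚ._+_ (f zero)) (sumℚ≡sum (f ∘ suc))

pos-sum : ∀ {n} (f : Fin n → ℕ) → + ℕΣ.sum f ≡ ℤΣ.sum (+_ ∘ f)
pos-sum {zero}  f = refl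
pos-sum {suc n} f = trans (ℤP.pos-+ (f zero) _) (cong (ℤ._+_ (+ f zero)) (pos-sum (f ∘ suc)))

≤-sum : ∀ {n} (f : Fin n → ℕ) t → f t ℕ.≤ ℕΣ.sum f
≤-sum f zero    = ℕP.m≤m+n _ _
≤-sum f (suc t) = ℕP.≤-trans (≤-sum (f ∘ suc) t) (ℕP.m≤n+m _ (f zero))

unitVector : ∀ {n} → Fin n → Fin n → ℕ
unitVector zero    zero    = 1
unitVector zero    (suc _) = 0
unitVector (suc _) zero    = 0
unitVector (suc t) (suc u) = unitVector t u

sum-unitVector : ∀ {n} (t : Fin n) → ℕΣ.sum (unitVector t) ≡ 1
sum-unitVector {suc n} zero    = cong suc (ℕΣ.sum-replicate-zero n)
sum-unitVector {suc n} (suc t) = sum-unitVector t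

sum-*-unitVector : ∀ {n} (f : Fin n → ℤ) t → ℤΣ.sum (λ u → f u ℤ.* + unitVector t u) ≡ f t
sum-*-unitVector {suc n} f zero = begin
  f zero ℤ.* ℤ.1ℤ ℤ.+ ℤΣ.sum {n} (λ u → f (suc u) ℤ.* ℤ.0ℤ)
    ≡⟨ cong₂ ℤ._+_ (ℤP.*-identityʳ (f zero)) (ℤΣ.sum-cong-≗ (λ u → ℤP.*-zeroʳ (f (suc u)))) ⟩
  f zero ℤ.+ ℤΣ.sum {n} (λ _ → ℤ.0ℤ)
    ≡⟨ cong (ℤ._+_ (f zero)) (ℤΣ.sum-replicate-zero n) ⟩
  f zero ℤ.+ ℤ.0ℤ
    ≡⟨ ℤP.+-identityʳ (f zero) ⟩
  f zero ∎
  where open ≡-Reasoning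
sum-*-unitVector {suc n} f (suc t) = begin
  f zero ℤ.* ℤ.0ℤ ℤ.+ rest ≡⟨ cong (ℤ._+ rest) (ℤP.*-zeroʳ (f zero)) ⟩
  ℤ.0ℤ ℤ.+ rest            ≡⟨ ℤP.+-identityˡ rest ⟩
  rest                     ≡⟨ sum-*-unitVector (f ∘ suc) t ⟩
  f (suc t)                ∎
  where
  open ≡-Reasoning
  rest : ℤ
  rest = ℤΣ.sum (λ u → f (suc u) ℤ.* + unitVector t u)

unitVector-≤ : ∀ {n} (z : Fin n → ℕ) {t} → 0 ℕ.< z t → ∀ u → unitVector t u ℕ.≤ z u
unitVector-≤ z {zero}  0<zt zero    = 0<zt
unitVector-≤ z {zero}  _    (suc u) = z≤n
unitVector-≤ z {suc t} _    zero    = z≤n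
unitVector-≤ z {suc t} 0<zt (suc u) = unitVector-≤ (z ∘ suc) 0<zt u

decrement : ∀ {n} → Fin n → (Fin n → ℕ) → Fin n → ℕ
decrement t z u = z u ℕ.∸ unitVector t u

unitVector-+-decrement : ∀ {n} (z : Fin n → ℕ) {t} → 0 ℕ.< z t →
  ∀ u → unitVector t u ℕ.+ decrement t z u ≡ z u
unitVector-+-decrement z 0<zt u = ℕP.m+[n∸m]≡n (unitVector-≤ z 0<zt u)

sum-decrement : ∀ {n} (z : Fin n → ℕ) {t} → 0 ℕ.< z t → ℕΣ.sum z ≡ suc (ℕΣ.sum (decrement t z))
sum-decrement z {t} 0<zt = begin
  ℕΣ.sum z                                          ≡⟨ ℕΣ.sum-cong-≗ (unitVector-+-decrement z 0<zt) ⟨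
  ℕΣ.sum (λ u → unitVector t u ℕ.+ decrement t z u) ≡⟨ ℕΣ.∑-distrib-+ (unitVector t) (decrement t z) ⟩
  ℕΣ.sum (unitVector t) ℕ.+ ℕΣ.sum (decrement t z)  ≡⟨ cong (ℕ._+ ℕΣ.sum (decrement t z)) (sum-unitVector t) ⟩
  suc (ℕΣ.sum (decrement t z))                      ∎
  where open ≡-Reasoning

balance⇔difference : ∀ a b c d → (a ℕ.+ d ≡ b ℕ.+ c) ⇔ (+ a ℤ.- + b ≡ + c ℤ.- + d)
balance⇔difference a b c d = mk⇔
  (λ balance → begin
    + a ℤ.- + b                       ≡⟨ shift (+ a) (+ b) (+ d) ⟩
    (+ a ℤ.+ + d) ℤ.- (+ b ℤ.+ + d)   ≡⟨ cong (ℤ._- (+ b ℤ.+ + d)) (casts balance) ⟩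
    (+ b ℤ.+ + c) ℤ.- (+ b ℤ.+ + d)   ≡⟨ cancel (+ b) (+ c) (+ d) ⟩
    + c ℤ.- + d                       ∎)
  (λ difference → ℤP.+-injective (begin
    + (a ℕ.+ d)                       ≡⟨ ℤP.pos-+ a d ⟩
    + a ℤ.+ + d                       ≡⟨ unshift (+ a) (+ b) (+ d) ⟩
    (+ a ℤ.- + b) ℤ.+ (+ b ℤ.+ + d)   ≡⟨ cong (ℤ._+ (+ b ℤ.+ + d)) difference ⟩
    (+ c ℤ.- + d) ℤ.+ (+ b ℤ.+ + d)   ≡⟨ uncancel (+ b) (+ c) (+ d) ⟩
    + b ℤ.+ + c                       ≡⟨ ℤP.pos-+ b c ⟨
    + (b ℕ.+ c)                       ∎))
  where
  open ≡-Reasoning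
  casts : a ℕ.+ d ≡ b ℕ.+ c → + a ℤ.+ + d ≡ + b ℤ.+ + c
  casts balance = trans (sym (ℤP.pos-+ a d)) (trans (cong +_ balance) (ℤP.pos-+ b c))
  shift : ∀ x y w → x ℤ.- y ≡ (x ℤ.+ w) ℤ.- (y ℤ.+ w)
  shift = solve-∀
  cancel : ∀ y z w → (y ℤ.+ z) ℤ.- (y ℤ.+ w) ≡ z ℤ.- w
  cancel = solve-∀
  unshift : ∀ x y w → x ℤ.+ w ≡ (x ℤ.- y) ℤ.+ (y ℤ.+ w)
  unshift = solve-∀
  uncancel : ∀ y z w → (z ℤ.- w) ℤ.+ (y ℤ.+ w) ≡ y ℤ.+ z
  uncancel = solve-∀

x≡y+z⇔z≡x-y : ∀ x y z → (x ≡ y ℤ.+ z) ⇔ (z ≡ x ℤ.- y)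
x≡y+z⇔z≡x-y x y z = mk⇔
  (λ x≡y+z → trans (sym (y+z-y≡z y z)) (cong (ℤ._- y) (sym x≡y+z)))
  (λ z≡x-y → trans (sym (y+[x-y]≡x x y)) (cong (ℤ._+_ y) (sym z≡x-y)))
  where
  y+z-y≡z : ∀ y z → (y ℤ.+ z) ℤ.- y ≡ z
  y+z-y≡z = solve-∀
  y+[x-y]≡x : ∀ x y → y ℤ.+ (x ℤ.- y) ≡ x
  y+[x-y]≡x = solve-∀

n*∣i∣≤m⇒0≤m+n*i : ∀ m n i → n ℕ.* ℤ.∣ i ∣ ℕ.≤ m → ℤ.0ℤ ℤ.≤ + m ℤ.+ + n ℤ.* i
n*∣i∣≤m⇒0≤m+n*i m n (+ k) _ =
  subst (ℤ.0ℤ ℤ.≤_) (trans (ℤP.pos-+ m (n ℕ.* k)) (cong (ℤ._+_ (+ m)) (ℤP.pos-* n k))) (ℤ.+≤+ z≤n)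
n*∣i∣≤m⇒0≤m+n*i m n -[1+ k ] n*∣i∣≤m =
  subst (λ j → ℤ.0ℤ ℤ.≤ + m ℤ.+ j)
    (trans (cong ℤ.-_ (ℤP.pos-* n (suc k))) (ℤP.neg-distribʳ-* (+ n) (+ suc k)))
    (ℤP.i≤j⇒0≤j-i (ℤ.+≤+ n*∣i∣≤m))

-- The embedding of ℤ into ℚ

ι : ℤ → ℚ
ι i = i ℚ./ 1

toℚᵘ-/ : ∀ i k → ℚ.toℚᵘ (i ℚ./ suc k) ℚᵘ.≃ mkℚᵘ i k
toℚᵘ-/ i k = ℚP.toℚᵘ-fromℚᵘ (mkℚᵘ i k)

ι-+ : ∀ i j → ι (i ℤ.+ j) ≡ ι i ℚ.+ ι j
ι-+ i j = ℚP.toℚᵘ-injective (begin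
  ℚ.toℚᵘ (ι (i ℤ.+ j))            ≈⟨ toℚᵘ-/ (i ℤ.+ j) 0 ⟩
  mkℚᵘ (i ℤ.+ j) 0                ≈⟨ *≡* (unit-denominators i j) ⟩
  mkℚᵘ i 0 ℚᵘ.+ mkℚᵘ j 0          ≈⟨ ℚᵘP.+-cong (toℚᵘ-/ i 0) (toℚᵘ-/ j 0) ⟨
  ℚ.toℚᵘ (ι i) ℚᵘ.+ ℚ.toℚᵘ (ι j)  ≈⟨ ℚP.toℚᵘ-homo-+ (ι i) (ι j) ⟨
  ℚ.toℚᵘ (ι i ℚ.+ ι j)            ∎)
  where
  open ℚᵘP.≃-Reasoning
  unit-denominators : ∀ i j → (i ℤ.+ j) ℤ.* ℤ.1ℤ ≡ (i ℤ.* ℤ.1ℤ ℤ.+ j ℤ.* ℤ.1ℤ) ℤ.* ℤ.1ℤ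
  unit-denominators = solve-∀

ι-* : ∀ i j → ι (i ℤ.* j) ≡ ι i ℚ.* ι j
ι-* i j = ℚP.toℚᵘ-injective (begin
  ℚ.toℚᵘ (ι (i ℤ.* j))            ≈⟨ toℚᵘ-/ (i ℤ.* j) 0 ⟩
  mkℚᵘ (i ℤ.* j) 0                ≈⟨ ℚᵘP.*-cong (toℚᵘ-/ i 0) (toℚᵘ-/ j 0) ⟨
  ℚ.toℚᵘ (ι i) ℚᵘ.* ℚ.toℚᵘ (ι j)  ≈⟨ ℚP.toℚᵘ-homo-* (ι i) (ι j) ⟨
  ℚ.toℚᵘ (ι i ℚ.* ι j)            ∎)
  where open ℚᵘP.≃-Reasoning

ι-pos-* : ∀ m n → ι (+ (m ℕ.* n)) ≡ ι (+ m) ℚ.* ι (+ n)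
ι-pos-* m n = trans (cong ι (ℤP.pos-* m n)) (ι-* (+ m) (+ n))

ι-injective : ∀ {i j} → ι i ≡ ι j → i ≡ j
ι-injective {i} {j} ιi≡ιj
  with ℚᵘP.≃-trans (ℚᵘP.≃-sym (toℚᵘ-/ i 0)) (ℚᵘP.≃-trans (ℚP.toℚᵘ-cong ιi≡ιj) (toℚᵘ-/ j 0))
... | *≡* i*1≡j*1 = trans (sym (ℤP.*-identityʳ i)) (trans i*1≡j*1 (ℤP.*-identityʳ j))

ι-sum : ∀ {n} (f : Fin n → ℤ) → ι (ℤΣ.sum f) ≡ ℚΣ.sum (ι ∘ f)
ι-sum {zero}  f = refl
ι-sum {suc n} f = trans (ι-+ (f zero) _) (cong (ℚ._+_ (ι (f zero))) (ι-sum (f ∘ suc)))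

ι-*-/ : ∀ i k → ι (+ suc k) ℚ.* (i ℚ./ suc k) ≡ ι i
ι-*-/ i k = ℚP.toℚᵘ-injective (begin
  ℚ.toℚᵘ (ι (+ suc k) ℚ.* (i ℚ./ suc k))          ≈⟨ ℚP.toℚᵘ-homo-* (ι (+ suc k)) (i ℚ./ suc k) ⟩
  ℚ.toℚᵘ (ι (+ suc k)) ℚᵘ.* ℚ.toℚᵘ (i ℚ./ suc k)  ≈⟨ ℚᵘP.*-cong (toℚᵘ-/ (+ suc k) 0) (toℚᵘ-/ i k) ⟩
  mkℚᵘ (+ suc k) 0 ℚᵘ.* mkℚᵘ i k                  ≈⟨ *≡* (trans (cancel (+ suc k) i) (cong (λ m → i ℤ.* + suc m) k≡k+0)) ⟩
  mkℚᵘ i 0                                         ≈⟨ toℚᵘ-/ i 0 ⟨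
  ℚ.toℚᵘ (ι i)                                     ∎)
  where
  open ℚᵘP.≃-Reasoning
  cancel : ∀ s i → (s ℤ.* i) ℤ.* ℤ.1ℤ ≡ i ℤ.* s
  cancel = solve-∀
  k≡k+0 : k ≡ k ℕ.+ 0
  k≡k+0 = sym (ℕP.+-identityʳ k)

ι-↥ : ∀ q → ι (↥ q) ≡ ι (↧ q) ℚ.* q
ι-↥ q@(mkℚ _ k _) = trans (sym (ι-*-/ (↥ q) k)) (cong (ι (↧ q) ℚ.*_) (ℚP.↥p/↧p≡p q))

ι-suc-cancelˡ : ∀ k {p q} → ι (+ suc k) ℚ.* p ≡ ι (+ suc k) ℚ.* q → p ≡ q
ι-suc-cancelˡ k {p} {q} eq = begin
  p                      ≡⟨ undo p ⟨
  ℚ.1/ c ℚ.* (c ℚ.* p)   ≡⟨ cong (ℚ.1/ c ℚ.*_) eq ⟩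
  ℚ.1/ c ℚ.* (c ℚ.* q)   ≡⟨ undo q ⟩
  q                      ∎
  where
  open ≡-Reasoning
  c : ℚ
  c = ι (+ suc k)
  instance
    c≢0 : ℚ.NonZero c
    c≢0 = ℚ.≢-nonZero λ c≡0 → case ι-injective {+ suc k} {ℤ.0ℤ} c≡0 of λ ()
  undo : ∀ r → ℚ.1/ c ℚ.* (c ℚ.* r) ≡ r
  undo r = trans (sym (ℚP.*-assoc (ℚ.1/ c) c r)) (trans (cong (ℚ._* r) (ℚP.*-inverseˡ c)) (ℚP.*-identityˡ r))

scaled-≡0⇔≡0 : ∀ k {i q} → ι i ≡ ι (+ suc k) ℚ.* q → (i ≡ ℤ.0ℤ ⇔ q ≡ 0ℚ)
scaled-≡0⇔≡0 k {i} {q} ιi≡cq = mk⇔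
  (λ i≡0 → ι-suc-cancelˡ k (trans (sym ιi≡cq) (trans (cong ι i≡0) (sym (ℚP.*-zeroʳ (ι (+ suc k)))))))
  (λ q≡0 → ι-injective (trans ιi≡cq (trans (cong (ι (+ suc k) ℚ.*_) q≡0) (ℚP.*-zeroʳ (ι (+ suc k))))))

numeratorℕ : ∀ q → 0ℚ ≤ q → ∃ λ k → ↥ q ≡ + k
numeratorℕ (mkℚ (+ k)      _ _) _            = k , refl
numeratorℕ (mkℚ -[1+ _ ] _ _) (ℚ.*≤* ())

commonDenominator : ∀ {n} (x : Fin n → ℚ) → (∀ t → 0ℚ ≤ x t) →
  Σ ℕ λ d → Σ (Fin n → ℕ) λ a → ∀ t → ι (+ a t) ≡ ι (+ suc d) ℚ.* x t
commonDenominator {zero}  x _   = 0 , (λ ()) , λ ()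
commonDenominator {suc n} x 0≤x
  with commonDenominator (x ∘ suc) (0≤x ∘ suc) | numeratorℕ (x zero) (0≤x zero)
... | d , a , scaled | k , ↥x₀≡k =
  ℕ.pred (suc d ℕ.* ↧ₙ x₀) , (λ { zero → k ℕ.* suc d ; (suc t) → a t ℕ.* ↧ₙ x₀ }) ,
  λ { zero → begin
        ι (+ (k ℕ.* suc d))                 ≡⟨ ι-pos-* k (suc d) ⟩
        ι (+ k) ℚ.* ι (+ suc d)             ≡⟨ cong (λ j → ι j ℚ.* ι (+ suc d)) ↥x₀≡k ⟨
        ι (↥ x₀) ℚ.* ι (+ suc d)            ≡⟨ cong (ℚ._* ι (+ suc d)) (ι-↥ x₀) ⟩
        ι (↧ x₀) ℚ.* x₀ ℚ.* ι (+ suc d)     ≡⟨ ℚ*.xy∙z≈zx∙y (ι (↧ x₀)) x₀ (ι (+ suc d)) ⟩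
        ι (+ suc d) ℚ.* ι (↧ x₀) ℚ.* x₀     ≡⟨ cong (ℚ._* x₀) (ι-pos-* (suc d) (↧ₙ x₀)) ⟨
        ι (+ (suc d ℕ.* ↧ₙ x₀)) ℚ.* x₀      ∎
    ; (suc t) → begin
        ι (+ (a t ℕ.* ↧ₙ x₀))                         ≡⟨ ι-pos-* (a t) (↧ₙ x₀) ⟩
        ι (+ a t) ℚ.* ι (↧ x₀)                        ≡⟨ cong (ℚ._* ι (↧ x₀)) (scaled t) ⟩
        ι (+ suc d) ℚ.* x (suc t) ℚ.* ι (↧ x₀)        ≡⟨ ℚ*.xy∙z≈xz∙y (ι (+ suc d)) (x (suc t)) (ι (↧ x₀)) ⟩
        ι (+ suc d) ℚ.* ι (↧ x₀) ℚ.* x (suc t)        ≡⟨ cong (ℚ._* x (suc t)) (ι-pos-* (suc d) (↧ₙ x₀)) ⟨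
        ι (+ (suc d ℕ.* ↧ₙ x₀)) ℚ.* x (suc t)         ∎ }
  where
  open ≡-Reasoning
  x₀ : ℚ
  x₀ = x zero

-- Minimal elements and the feeding relation

module _ {n ℓ} {_≺_ : Rel (Fin n) ℓ} (_≺?_ : Decidable _≺_) where

  acc⇒minimal : ∀ {p} {P : Pred (Fin n) p} → U.Decidable P →
    ∀ {t} → Acc _≺_ t → P t → ∃ λ m → P m × (∀ {u} → P u → ¬ u ≺ m)
  acc⇒minimal P? {t} (acc rec) Pt with any? (λ u → P? u ×-dec u ≺? t)
  ... | yes (u , Pu , u≺t) = acc⇒minimal P? (rec u≺t) Pu
  ... | no nothing-below   = t , Pt , λ Pu u≺t → nothing-below (_ , Pu , u≺t)

Feeds : PetriNet np nt → Rel (Fin nt) 0ℓ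
Feeds {np} N u t = ∃ λ (p : Fin np) → 0 ℕ.< Post N p u × 0 ℕ.< Pre N p t

feeds? : (N : PetriNet np nt) → Decidable (Feeds N)
feeds? N u t = any? (λ p → (0 ℕ.<? Post N p u) ×-dec (0 ℕ.<? Pre N p t))

effect : PetriNet np nt → (Fin nt → ℤ) → Fin np → ℤ
effect N v p = ℤΣ.sum (λ t → incidence N p t ℤ.* v t)

HasEffect : PetriNet np nt → (Fin nt → ℤ) → (Fin np → ℤ) → Set
HasEffect N v d = ∀ p → effect N v p ≡ d p

displacement : Marking np → Marking np → Fin np → ℤ
displacement M M' p = + M' p ℤ.- + M p

displacement-trans : ∀ (M M₁ M' : Marking np) p →
  displacement M M₁ p ℤ.+ displacement M₁ M' p ≡ displacement M M' p
displacement-trans M M₁ M' p =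
  trans (ℤP.+-comm (displacement M M₁ p) _) (ℤP.+-minus-telescope (+ M' p) (+ M₁ p) (+ M p))

displacement-scale : ∀ n (M M' : Marking np) p →
  displacement (n · M) (n · M') p ≡ + n ℤ.* displacement M M' p
displacement-scale n M M' p = begin
  + (n ℕ.* M' p) ℤ.- + (n ℕ.* M p)        ≡⟨ cong₂ ℤ._-_ (ℤP.pos-* n (M' p)) (ℤP.pos-* n (M p)) ⟩
  + n ℤ.* + M' p ℤ.- + n ℤ.* + M p        ≡⟨ distrib (+ n) (+ M' p) (+ M p) ⟨
  + n ℤ.* displacement M M' p             ∎
  where
  open ≡-Reasoning
  distrib : ∀ x y z → x ℤ.* (y ℤ.- z) ≡ x ℤ.* y ℤ.- x ℤ.* z
  distrib = solve-∀

production consumption : PetriNet np nt → (Fin nt → ℕ) → Fin np → ℕ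
production  N z p = ℕΣ.sum (λ u → Post N p u ℕ.* z u)
consumption N z p = ℕΣ.sum (λ u → Pre N p u ℕ.* z u)

module _ (N : PetriNet np nt) where

  effect-cong : ∀ {u w} → (∀ t → u t ≡ w t) → ∀ p → effect N u p ≡ effect N w p
  effect-cong u≗w p = ℤΣ.sum-cong-≗ (λ t → cong (incidence N p t ℤ.*_) (u≗w t))

  effect-zero : HasEffect N (λ _ → ℤ.0ℤ) (λ _ → ℤ.0ℤ)
  effect-zero p = trans (ℤΣ.sum-cong-≗ (ℤP.*-zeroʳ ∘ incidence N p)) (ℤΣ.sum-replicate-zero nt)

  effect-unitVector : ∀ t → HasEffect N (+_ ∘ unitVector t) (λ p → incidence N p t)
  effect-unitVector t p = sum-*-unitVector (incidence N p) t

  hasEffect-+ : ∀ {u w d e} → HasEffect N u d → HasEffect N w e →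
    HasEffect N (λ t → u t ℤ.+ w t) (λ p → d p ℤ.+ e p)
  hasEffect-+ {u} {w} {d} {e} hu hw p = begin
    ℤΣ.sum (λ t → A t ℤ.* (u t ℤ.+ w t))       ≡⟨ ℤΣ.sum-cong-≗ (λ t → ℤP.*-distribˡ-+ (A t) (u t) (w t)) ⟩
    ℤΣ.sum (λ t → A t ℤ.* u t ℤ.+ A t ℤ.* w t) ≡⟨ ℤΣ.∑-distrib-+ (λ t → A t ℤ.* u t) (λ t → A t ℤ.* w t) ⟩
    effect N u p ℤ.+ effect N w p              ≡⟨ cong₂ ℤ._+_ (hu p) (hw p) ⟩
    d p ℤ.+ e p                                ∎
    where
    open ≡-Reasoning
    A : Fin nt → ℤ
    A = incidence N p

  hasEffect-* : ∀ c {u d} → HasEffect N u d → HasEffect N (λ t → c ℤ.* u t) (λ p → c ℤ.* d p)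
  hasEffect-* c {u} {d} hu p = begin
    ℤΣ.sum (λ t → A t ℤ.* (c ℤ.* u t)) ≡⟨ ℤΣ.sum-cong-≗ (λ t → ℤ*.x∙yz≈y∙xz (A t) c (u t)) ⟩
    ℤΣ.sum (λ t → c ℤ.* (A t ℤ.* u t)) ≡⟨ ℤΣ.*-distribˡ-sum c (λ t → A t ℤ.* u t) ⟨
    c ℤ.* effect N u p                 ≡⟨ cong (c ℤ.*_) (hu p) ⟩
    c ℤ.* d p                          ∎
    where
    open ≡-Reasoning
    A : Fin nt → ℤ
    A = incidence N p

  effect-pos : ∀ z p → effect N (+_ ∘ z) p ≡ + production N z p ℤ.- + consumption N z p
  effect-pos z p = begin
    ℤΣ.sum (λ u → incidence N p u ℤ.* + z u)
      ≡⟨ ℤΣ.sum-cong-≗ split ⟩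
    ℤΣ.sum (λ u → + produced u ℤ.+ ℤ.-1ℤ ℤ.* + consumed u)
      ≡⟨ ℤΣ.∑-distrib-+ (+_ ∘ produced) (λ u → ℤ.-1ℤ ℤ.* + consumed u) ⟩
    ℤΣ.sum (+_ ∘ produced) ℤ.+ ℤΣ.sum (λ u → ℤ.-1ℤ ℤ.* + consumed u)
      ≡⟨ cong (ℤ._+_ (ℤΣ.sum (+_ ∘ produced))) (ℤΣ.*-distribˡ-sum ℤ.-1ℤ (+_ ∘ consumed)) ⟨
    ℤΣ.sum (+_ ∘ produced) ℤ.+ ℤ.-1ℤ ℤ.* ℤΣ.sum (+_ ∘ consumed)
      ≡⟨ cong₂ (λ i j → i ℤ.+ ℤ.-1ℤ ℤ.* j) (pos-sum produced) (pos-sum consumed) ⟨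
    + production N z p ℤ.+ ℤ.-1ℤ ℤ.* + consumption N z p
      ≡⟨ cong (ℤ._+_ (+ production N z p)) (ℤP.-1*i≡-i (+ consumption N z p)) ⟩
    + production N z p ℤ.- + consumption N z p ∎
    where
    open ≡-Reasoning
    produced consumed : Fin nt → ℕ
    produced u = Post N p u ℕ.* z u
    consumed u = Pre N p u ℕ.* z u
    distrib : ∀ a b c → (a ℤ.- b) ℤ.* c ≡ a ℤ.* c ℤ.+ ℤ.-1ℤ ℤ.* (b ℤ.* c)
    distrib = solve-∀
    split : ∀ u → incidence N p u ℤ.* + z u ≡ + produced u ℤ.+ ℤ.-1ℤ ℤ.* + consumed u
    split u = trans (distrib (+ Post N p u) (+ Pre N p u) (+ z u))
      (sym (cong₂ (λ i j → i ℤ.+ ℤ.-1ℤ ℤ.* j) (ℤP.pos-* (Post N p u) (z u)) (ℤP.pos-* (Pre N p u) (z u))))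

  hasEffect⇒conservation : ∀ {M M' z} → HasEffect N (+_ ∘ z) (displacement M M') →
    ∀ p → M' p ℕ.+ consumption N z p ≡ M p ℕ.+ production N z p
  hasEffect⇒conservation {M} {M'} {z} hz p =
    Equivalence.from (balance⇔difference (M' p) (M p) (production N z p) (consumption N z p))
      (trans (sym (hz p)) (effect-pos z p))

  fires⇒displacement : ∀ {M t M₁} → Fires N M t M₁ → ∀ p → displacement M M₁ p ≡ incidence N p t
  fires⇒displacement {M} {t} {M₁} (_ , balance) p =
    Equivalence.to (balance⇔difference (M₁ p) (M p) (Post N p t) (Pre N p t)) (balance p)

  parikhVector : ∀ {M M'} → Reach N M M' → ∃ λ (v : Fin nt → ℕ) → HasEffect N (+_ ∘ v) (displacement M M')
  parikhVector (done M≗M') =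
    (λ _ → 0) , λ p → trans (effect-zero p) (sym (ℤP.i≡j⇒i-j≡0 (cong +_ (sym (M≗M' p)))))
  parikhVector {M} {M'} (step {M₁ = M₁} t fires reach) with parikhVector reach
  ... | v , hv = (λ u → unitVector t u ℕ.+ v u) , λ p → begin
    effect N (λ u → + (unitVector t u ℕ.+ v u)) p
      ≡⟨ effect-cong (λ u → ℤP.pos-+ (unitVector t u) (v u)) p ⟩
    effect N (λ u → + unitVector t u ℤ.+ + v u) p
      ≡⟨ hasEffect-+ (effect-unitVector t) hv p ⟩
    incidence N p t ℤ.+ displacement M₁ M' p
      ≡⟨ cong (ℤ._+ displacement M₁ M' p) (fires⇒displacement fires p) ⟨
    displacement M M₁ p ℤ.+ displacement M₁ M' p
      ≡⟨ displacement-trans M M₁ M' p ⟩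
    displacement M M' p ∎
    where open ≡-Reasoning

  -- Realising solutions in acyclic nets

  feeds⁺⇒path : ∀ {u t} → TransClosure (Feeds N) u t → Path N (inj₂ u) (inj₂ t)
  feeds⁺⇒path [ p , u→p , p→t ]        = cons {v = inj₁ p} u→p (edge p→t)
  feeds⁺⇒path ((p , u→p , p→v) ∷ v⁺t) = cons {v = inj₁ p} u→p (cons p→v (feeds⁺⇒path v⁺t))

  feeds-wellFounded : Acyclic N → WellFounded (Feeds N)
  feeds-wellFounded acyclic = wellFounded⁻ _ (spo-wellFounded record
    { isEquivalence = isEquivalence
    ; irrefl        = λ { refl t⁺t → acyclic _ (feeds⁺⇒path t⁺t) }
    ; trans         = _++_
    ; <-resp-≈      = resp₂ _
    })

  support-has-source : Acyclic N → ∀ (z : Fin nt → ℕ) {t} → 0 ℕ.< z t →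
    ∃ λ t₀ → 0 ℕ.< z t₀ × (∀ {u} → 0 ℕ.< z u → ¬ Feeds N u t₀)
  support-has-source acyclic z 0<zt =
    acc⇒minimal (feeds? N) (λ u → 0 ℕ.<? z u) (feeds-wellFounded acyclic _) 0<zt

  -- No transition counted by z produces into an input place p of t, so the conservation law
  -- reads M p = M' p + consumption N z p ≥ Pre N p t.
  source-enabled : ∀ {M M' z t} → HasEffect N (+_ ∘ z) (displacement M M') →
    0 ℕ.< z t → (∀ {u} → 0 ℕ.< z u → ¬ Feeds N u t) → Enabled N M t
  source-enabled {M} {M'} {z} {t} hz 0<zt source p with 0 ℕ.<? Pre N p t
  ... | no ¬0<pre = ℕP.≤-trans (ℕP.≮⇒≥ ¬0<pre) z≤n
  ... | yes 0<pre = begin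
    Pre N p t                   ≤⟨ ℕP.m≤m*n (Pre N p t) (z t) {{ℕ.>-nonZero 0<zt}} ⟩
    Pre N p t ℕ.* z t           ≤⟨ ≤-sum (λ u → Pre N p u ℕ.* z u) t ⟩
    consumption N z p           ≤⟨ ℕP.m≤n+m _ (M' p) ⟩
    M' p ℕ.+ consumption N z p  ≡⟨ hasEffect⇒conservation {M} {M'} {z} hz p ⟩
    M p ℕ.+ production N z p    ≡⟨ cong (M p ℕ.+_) no-production ⟩
    M p ℕ.+ 0                   ≡⟨ ℕP.+-identityʳ (M p) ⟩
    M p                         ∎
    where
    open ℕP.≤-Reasoning
    idle : ∀ u → Post N p u ℕ.* z u ≡ 0
    idle u with 0 ℕ.<? z u | 0 ℕ.<? Post N p u
    ... | no ¬0<zu | _          = trans (cong (Post N p u ℕ.*_) (ℕP.n≤0⇒n≡0 (ℕP.≮⇒≥ ¬0<zu))) (ℕP.*-zeroʳ (Post N p u))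
    ... | yes _    | no ¬0<post = cong (ℕ._* z u) (ℕP.n≤0⇒n≡0 (ℕP.≮⇒≥ ¬0<post))
    ... | yes 0<zu | yes 0<post = contradiction (p , 0<post , 0<pre) (source 0<zu)
    no-production : production N z p ≡ 0
    no-production = trans (ℕΣ.sum-cong-≗ idle) (ℕΣ.sum-replicate-zero nt)

  fire : ∀ {M t} → Enabled N M t → Fires N M t (λ p → M p ℕ.∸ Pre N p t ℕ.+ Post N p t)
  fire {M} {t} enabled = enabled , λ p →
    trans (ℕ+.xy∙z≈xz∙y (M p ℕ.∸ Pre N p t) _ _) (cong (ℕ._+ Post N p t) (ℕP.m∸n+n≡m (enabled p)))

  hasEffect-decrement : ∀ {M M' M₁ z t} → HasEffect N (+_ ∘ z) (displacement M M') → Fires N M t M₁ →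
    0 ℕ.< z t → HasEffect N (+_ ∘ decrement t z) (displacement M₁ M')
  hasEffect-decrement {M} {M'} {M₁} {z} {t} hz fires 0<zt p = ℤ+.∙-cancelˡ (displacement M M₁ p) _ _ (begin
    displacement M M₁ p ℤ.+ effect N (+_ ∘ decrement t z) p
      ≡⟨ cong (ℤ._+ effect N (+_ ∘ decrement t z) p) (fires⇒displacement fires p) ⟩
    incidence N p t ℤ.+ effect N (+_ ∘ decrement t z) p
      ≡⟨ hasEffect-+ (effect-unitVector t) (λ _ → refl) p ⟨
    effect N (λ u → + unitVector t u ℤ.+ + decrement t z u) p
      ≡⟨ effect-cong (λ u → trans (sym (ℤP.pos-+ (unitVector t u) _)) (cong +_ (unitVector-+-decrement z 0<zt u))) p ⟩
    effect N (+_ ∘ z) p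
      ≡⟨ hz p ⟩
    displacement M M' p
      ≡⟨ displacement-trans M M₁ M' p ⟨
    displacement M M₁ p ℤ.+ displacement M₁ M' p ∎)
    where open ≡-Reasoning

  hasEffect⇒reach : Acyclic N → ∀ {M M'} (z : Fin nt → ℕ) →
    HasEffect N (+_ ∘ z) (displacement M M') → Reach N M M'
  hasEffect⇒reach acyclic z = go (ℕΣ.sum z) z refl
    where
    go : ∀ k (z : Fin nt → ℕ) → ℕΣ.sum z ≡ k → ∀ {M M'} →
      HasEffect N (+_ ∘ z) (displacement M M') → Reach N M M'
    go k z _ {M} {M'} hz with any? (λ t → 0 ℕ.<? z t)
    ... | no ¬support = done λ p → sym (ℤP.+-injective (ℤP.i-j≡0⇒i≡j _ _ (begin
      displacement M M' p      ≡⟨ hz p ⟨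
      effect N (+_ ∘ z) p      ≡⟨ effect-cong (λ t → cong +_ (ℕP.n≤0⇒n≡0 (ℕP.≮⇒≥ (¬support ∘ (t ,_))))) p ⟩
      effect N (λ _ → ℤ.0ℤ) p  ≡⟨ effect-zero p ⟩
      ℤ.0ℤ                     ∎)))
      where open ≡-Reasoning
    go zero    z Σz≡0 hz | yes (t , 0<zt) =
      contradiction (ℕP.≤-trans (≤-sum z t) (ℕP.≤-reflexive Σz≡0)) (ℕP.<⇒≱ 0<zt)
    go (suc k) z Σz≡k {M} hz | yes (t , 0<zt) with support-has-source acyclic z 0<zt
    ... | t₀ , 0<zt₀ , source =
      step t₀ fires (go k (decrement t₀ z) (ℕP.suc-injective (trans (sym (sum-decrement z 0<zt₀)) Σz≡k))
                      (hasEffect-decrement hz fires 0<zt₀))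
      where
      fires : Fires N M t₀ (λ p → M p ℕ.∸ Pre N p t₀ ℕ.+ Post N p t₀)
      fires = fire (source-enabled hz 0<zt₀ source)

-- Cut-offs

Solvable : PetriNet np nt → Marking np → Marking np → Set
Solvable {nt = nt} N M M' = Σ (Fin nt → ℚ) λ x → Σ (Fin nt → ℤ) λ y →
  (∀ t → 0ℚ ≤ x t) × MarkingEqℚ N M M' x × MarkingEqℤ N M M' y × SuppSubset y x

module _ (N : PetriNet np nt) {M M' : Marking np} where

  reach⇒scaledParikhVector : ∀ n → Reach N (n · M) (n · M') →
    ∃ λ (v : Fin nt → ℕ) → HasEffect N (+_ ∘ v) (λ p → + n ℤ.* displacement M M' p)
  reach⇒scaledParikhVector n reach with parikhVector N reach
  ... | v , hv = v , λ p → trans (hv p) (displacement-scale n M M' p)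

  cutoff⇒integerSolutions : AdmitsCutoff N M M' →
    Σ ℕ λ k → Σ (Fin nt → ℕ) λ w → Σ (Fin nt → ℤ) λ y →
      HasEffect N (+_ ∘ w) (λ p → + suc k ℤ.* displacement M M' p) ×
      HasEffect N y (displacement M M') ×
      (∀ t → y t ≢ ℤ.0ℤ → w t ≢ 0)
  cutoff⇒integerSolutions (B , reach)
    with reach⇒scaledParikhVector (suc B) (reach (suc B) (ℕP.n≤1+n B)) | reach⇒scaledParikhVector B (reach B ℕP.≤-refl)
  ... | v₁ , h₁ | v₀ , h₀ = B ℕ.+ B , w , y , hw , hy , supp
    where
    w : Fin nt → ℕ
    w t = v₁ t ℕ.+ v₀ t
    y : Fin nt → ℤ
    y t = + v₁ t ℤ.+ ℤ.-1ℤ ℤ.* + v₀ t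
    hw : HasEffect N (+_ ∘ w) (λ p → + suc (B ℕ.+ B) ℤ.* displacement M M' p)
    hw p = begin
      effect N (+_ ∘ w) p
        ≡⟨ effect-cong N (λ t → ℤP.pos-+ (v₁ t) (v₀ t)) p ⟩
      effect N (λ t → + v₁ t ℤ.+ + v₀ t) p
        ≡⟨ hasEffect-+ N h₁ h₀ p ⟩
      + suc B ℤ.* displacement M M' p ℤ.+ + B ℤ.* displacement M M' p
        ≡⟨ ℤP.*-distribʳ-+ (displacement M M' p) (+ suc B) (+ B) ⟨
      + suc (B ℕ.+ B) ℤ.* displacement M M' p ∎
      where open ≡-Reasoning
    hy : HasEffect N y (displacement M M')
    hy p = trans (hasEffect-+ N h₁ (hasEffect-* N ℤ.-1ℤ h₀) p) (consecutive (+ B) (displacement M M' p))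
      where
      consecutive : ∀ b δ → (ℤ.1ℤ ℤ.+ b) ℤ.* δ ℤ.+ ℤ.-1ℤ ℤ.* (b ℤ.* δ) ≡ δ
      consecutive = solve-∀
    supp : ∀ t → y t ≢ ℤ.0ℤ → w t ≢ 0
    supp t y≢0 w≡0 =
      y≢0 (cong₂ (λ i j → + i ℤ.+ ℤ.-1ℤ ℤ.* + j) (ℕP.m+n≡0⇒m≡0 (v₁ t) w≡0) (ℕP.m+n≡0⇒n≡0 (v₁ t) w≡0))

  -- n ≥ D Y D forces q = n / D ≥ D Y, so q a t ≥ r ∣y t∣ wherever y t ≠ 0 (then a t ≥ 1).
  integerSolutions⇒cutoff : Acyclic N → ∀ d (a : Fin nt → ℕ) (y : Fin nt → ℤ) →
    HasEffect N (+_ ∘ a) (λ p → + suc d ℤ.* displacement M M' p) →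
    HasEffect N y (displacement M M') →
    (∀ t → y t ≢ ℤ.0ℤ → a t ≢ 0) →
    AdmitsCutoff N M M'
  integerSolutions⇒cutoff acyclic d a y ha hy supp = D ℕ.* Y ℕ.* D , λ n B≤n →
    hasEffect⇒reach N acyclic (ℤ.∣_∣ ∘ z n) λ p →
      trans (effect-cong N (λ t → ℤP.0≤i⇒+∣i∣≡i (0≤z n B≤n t)) p) (effect-z n p)
    where
    D Y : ℕ
    D = suc d
    Y = ℕΣ.sum (ℤ.∣_∣ ∘ y)
    z : ℕ → Fin nt → ℤ
    z n t = + (n / D) ℤ.* + a t ℤ.+ + (n % D) ℤ.* y t
    effect-z : ∀ n → HasEffect N (z n) (displacement (n · M) (n · M'))
    effect-z n p = begin
      effect N (z n) p
        ≡⟨ hasEffect-+ N (hasEffect-* N (+ (n / D)) ha) (hasEffect-* N (+ (n % D)) hy) p ⟩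
      + (n / D) ℤ.* (+ D ℤ.* displacement M M' p) ℤ.+ + (n % D) ℤ.* displacement M M' p
        ≡⟨ regroup (+ (n / D)) (+ D) (+ (n % D)) (displacement M M' p) ⟩
      (+ (n % D) ℤ.+ + (n / D) ℤ.* + D) ℤ.* displacement M M' p
        ≡⟨ cong (ℤ._* displacement M M' p) n≡r+qD ⟨
      + n ℤ.* displacement M M' p
        ≡⟨ displacement-scale n M M' p ⟨
      displacement (n · M) (n · M') p ∎
      where
      open ≡-Reasoning
      regroup : ∀ q D r δ → q ℤ.* (D ℤ.* δ) ℤ.+ r ℤ.* δ ≡ (r ℤ.+ q ℤ.* D) ℤ.* δ
      regroup = solve-∀
      n≡r+qD : + n ≡ + (n % D) ℤ.+ + (n / D) ℤ.* + D
      n≡r+qD = trans (cong +_ (m≡m%n+[m/n]*n n D))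
        (trans (ℤP.pos-+ (n % D) _) (cong (ℤ._+_ (+ (n % D))) (ℤP.pos-* (n / D) D)))
    remainder-bound : ∀ n → D ℕ.* Y ℕ.* D ℕ.≤ n → ∀ t → (n % D) ℕ.* ℤ.∣ y t ∣ ℕ.≤ (n / D) ℕ.* a t
    remainder-bound n B≤n t with y t ℤ.≟ ℤ.0ℤ
    ... | yes y≡0 rewrite y≡0 | ℕP.*-zeroʳ (n % D) = z≤n
    ... | no y≢0 = begin
      (n % D) ℕ.* ℤ.∣ y t ∣  ≤⟨ ℕP.*-monoˡ-≤ ℤ.∣ y t ∣ (ℕP.<⇒≤ (m%n<n n D)) ⟩
      D ℕ.* ℤ.∣ y t ∣        ≤⟨ ℕP.*-monoʳ-≤ D (≤-sum (ℤ.∣_∣ ∘ y) t) ⟩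
      D ℕ.* Y                ≡⟨ m*n/n≡m (D ℕ.* Y) D ⟨
      D ℕ.* Y ℕ.* D / D      ≤⟨ /-monoˡ-≤ D B≤n ⟩
      n / D                  ≤⟨ ℕP.m≤m*n (n / D) (a t) {{ℕ.≢-nonZero (supp t y≢0)}} ⟩
      (n / D) ℕ.* a t        ∎
      where open ℕP.≤-Reasoning
    0≤z : ∀ n → D ℕ.* Y ℕ.* D ℕ.≤ n → ∀ t → ℤ.0ℤ ℤ.≤ z n t
    0≤z n B≤n t = subst (λ j → ℤ.0ℤ ℤ.≤ j ℤ.+ + (n % D) ℤ.* y t) (ℤP.pos-* (n / D) (a t))
      (n*∣i∣≤m⇒0≤m+n*i ((n / D) ℕ.* a t) (n % D) (y t) (remainder-bound n B≤n t))

  markingEqℤ⇔hasEffect : ∀ y → MarkingEqℤ N M M' y ⇔ HasEffect N y (displacement M M')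
  markingEqℤ⇔hasEffect y = mk⇔
    (λ eq p → trans (sym (sumℤ≡sum (A p))) (Equivalence.to (x≡y+z⇔z≡x-y (+ M' p) (+ M p) _) (eq p)))
    (λ hy p → Equivalence.from (x≡y+z⇔z≡x-y (+ M' p) (+ M p) _) (trans (sumℤ≡sum (A p)) (hy p)))
    where
    A : Fin np → Fin nt → ℤ
    A p t = incidence N p t ℤ.* y t

  markingEqℚ⇔hasEffect : ∀ d (a : Fin nt → ℤ) (x : Fin nt → ℚ) → (∀ t → ι (a t) ≡ ι (+ suc d) ℚ.* x t) →
    MarkingEqℚ N M M' x ⇔ HasEffect N a (λ p → + suc d ℤ.* displacement M M' p)
  markingEqℚ⇔hasEffect d a x scaled = mk⇔
    (λ eq p → ι-injective (begin
      ι (effect N a p)                        ≡⟨ scaled-sum p ⟨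
      c ℚ.* Sℚ p                              ≡⟨ cong (c ℚ.*_) (ι-displacement eq p) ⟨
      c ℚ.* ι (displacement M M' p)           ≡⟨ ι-* (+ suc d) (displacement M M' p) ⟨
      ι (+ suc d ℤ.* displacement M M' p)     ∎))
    (λ ha p → begin
      ι (+ M' p)                              ≡⟨ ι-M+Δ p ⟨
      ι (+ M p) ℚ.+ ι (displacement M M' p)   ≡⟨ cong (ι (+ M p) ℚ.+_) (ι-suc-cancelˡ d (begin
        c ℚ.* ι (displacement M M' p)           ≡⟨ ι-* (+ suc d) (displacement M M' p) ⟨
        ι (+ suc d ℤ.* displacement M M' p)     ≡⟨ cong ι (ha p) ⟨
        ι (effect N a p)                        ≡⟨ scaled-sum p ⟨
        c ℚ.* Sℚ p                              ∎)) ⟩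
      ι (+ M p) ℚ.+ Sℚ p                      ∎)
    where
    open ≡-Reasoning
    c : ℚ
    c = ι (+ suc d)
    Sℚ : Fin np → ℚ
    Sℚ p = sumℚ (λ t → ι (incidence N p t) ℚ.* x t)
    ι-M+Δ : ∀ p → ι (+ M p) ℚ.+ ι (displacement M M' p) ≡ ι (+ M' p)
    ι-M+Δ p = trans (sym (ι-+ (+ M p) (displacement M M' p)))
      (cong ι (sym (Equivalence.from (x≡y+z⇔z≡x-y (+ M' p) (+ M p) _) refl)))
    ι-displacement : MarkingEqℚ N M M' x → ∀ p → ι (displacement M M' p) ≡ Sℚ p
    ι-displacement eq p = ℚ+.∙-cancelˡ (ι (+ M p)) _ _ (trans (ι-M+Δ p) (eq p))
    scaled-sum : ∀ p → c ℚ.* Sℚ p ≡ ι (effect N a p)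
    scaled-sum p = begin
      c ℚ.* Sℚ p
        ≡⟨ cong (c ℚ.*_) (sumℚ≡sum (λ t → ι (incidence N p t) ℚ.* x t)) ⟩
      c ℚ.* ℚΣ.sum (λ t → ι (incidence N p t) ℚ.* x t)
        ≡⟨ ℚΣ.*-distribˡ-sum c (λ t → ι (incidence N p t) ℚ.* x t) ⟩
      ℚΣ.sum (λ t → c ℚ.* (ι (incidence N p t) ℚ.* x t))
        ≡⟨ ℚΣ.sum-cong-≗ (λ t → trans (ℚ*.x∙yz≈y∙xz c (ι (incidence N p t)) (x t))
                                       (cong (ι (incidence N p t) ℚ.*_) (sym (scaled t)))) ⟩
      ℚΣ.sum (λ t → ι (incidence N p t) ℚ.* ι (a t))
        ≡⟨ ℚΣ.sum-cong-≗ (λ t → ι-* (incidence N p t) (a t)) ⟨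
      ℚΣ.sum (λ t → ι (incidence N p t ℤ.* a t))
        ≡⟨ ι-sum (λ t → incidence N p t ℤ.* a t) ⟨
      ι (effect N a p) ∎

  cutoff⇒solvable : AdmitsCutoff N M M' → Solvable N M M'
  cutoff⇒solvable cutoff with cutoff⇒integerSolutions cutoff
  ... | k , w , y , hw , hy , supp =
    x , y , 0≤x , Equivalence.from (markingEqℚ⇔hasEffect k (+_ ∘ w) x scaled) hw ,
    Equivalence.from (markingEqℤ⇔hasEffect y) hy ,
    λ t y≢0 x≡0 → supp t y≢0 (ℤP.+-injective (Equivalence.from (scaled-≡0⇔≡0 k (scaled t)) x≡0))
    where
    x : Fin nt → ℚ
    x t = + w t ℚ./ suc k
    scaled : ∀ t → ι (+ w t) ≡ ι (+ suc k) ℚ.* x t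
    scaled t = sym (ι-*-/ (+ w t) k)
    0≤x : ∀ t → 0ℚ ≤ x t
    0≤x t = ℚP.nonNegative⁻¹ (x t) {{ℚP.normalize-nonNeg (w t) (suc k)}}

  solvable⇒cutoff : Acyclic N → Solvable N M M' → AdmitsCutoff N M M'
  solvable⇒cutoff acyclic (x , y , 0≤x , eqℚ , eqℤ , supp) with commonDenominator x 0≤x
  ... | d , a , scaled = integerSolutions⇒cutoff acyclic d a y
    (Equivalence.to (markingEqℚ⇔hasEffect d (+_ ∘ a) x scaled) eqℚ)
    (Equivalence.to (markingEqℤ⇔hasEffect y) eqℤ)
    λ t y≢0 a≡0 → supp t y≢0 (Equivalence.to (scaled-≡0⇔≡0 d (scaled t)) (cong +_ a≡0))

theorem3p3 : ∀ {np nt} (N : PetriNet np nt) (M M' : Marking np) →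
    ¬ (∀ p → M p ≡ M' p) → Acyclic N →
    AdmitsCutoff N M M' ⇔
      (Σ (Fin nt → ℚ) λ x → Σ (Fin nt → ℤ) λ y →
        (∀ t → 0ℚ ≤ x t) × MarkingEqℚ N M M' x × MarkingEqℤ N M M' y × SuppSubset y x)
theorem3p3 N M M' _ acyclic = mk⇔ (cutoff⇒solvable N) (solvable⇒cutoff N acyclic)
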